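{- Let $(M,c)\in\mathrm{Col}$ and let $(v_1,v_2,\dots)$ be an infinite path in $M$, i.e., $(v_i,v_{i+1})\in\mathrm{proc}\cup\mathrm{msg}$ for all $i\ge1$. Then there exist infinitely many $i\in\mathbb N$ with $c(v_i)\neq c(v_{i+1})$.
   Context: Fix a finite set $\mathcal P$ of processes, $\mathrm{Ch}=\{(p,q)\in\mathcal P^2:p\ne q\}$, $\Sigma_p=\{p!q,p?q:q\ne p\}$, $\Sigma=\bigcup_p\Sigma_p$. For a $\Sigma$-labeled poset $(V,\le,\lambda)$, $P(v)=p$ iff $\lambda(v)\in\Sigma_p$, $V_p=P^{ -1}(p)$; $(v,v')\in\mathrm{proc}$ iff $P(v)=P(v')$, $v<v'$, no node of that process strictly between; $(v,v')\in\mathrm{msg}$ iff for some $(p,q)\in\mathrm{Ch}$, $\lambda(v)=p!q$, $\lambda(v')=q?p$ and $|\{u\le v:\lambda(u)=p!q\}|=|\{u\le v':\lambda(u)=q?p\}|$. An MSC is such a structure with $\le=(\mathrm{proc}\cup\mathrm{msg})^*$, all down-sets finite, each $V_p$ linearly ordered, $|\lambda^{ -1}(p!q)|=|\lambda^{ -1}(q?p)|$ for all channels. For an MSC $M$ and $c:V\to\{0,1\}$, let $u\sim w$ iff $P(u)=P(w)$ and, for all $v$ with ($u\le v\le w$ or $w\le v\le u$) and $P(v)=P(u)$, $c(u)=c(v)=c(w)$. $\mathrm{Col}$ is the set of all pairs $(M,c)$, $c:V\to\{0,1\}$, such that: (1) if $v$ is minimal on its process then $c(v)=1$; (2) if $(v,v')\in\mathrm{msg}$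 and $w'\le v'$ with $P(w')=P(v')$, then there is $(u,u')\in\mathrm{msg}$ with $\lambda(u')=\lambda(v')$, $c(u)=c(u')$ and $u'\sim w'$; (3) every $\sim$-class is finite. -}

module Defs where

open import Data.Nat using (ℕ; suc)
open import Data.Fin using (Fin)
open import Data.Bool using (Bool; true)
open import Data.List using (List; length)
open import Data.List.Membership.Propositional using (_∈_)
open import Data.List.Relation.Unary.Unique.Propositional using (Unique)
open import Data.Product using (Σ; ∃; ∃-syntax; _×_; _,_)
open import Data.Sum using (_⊎_)
open import Relation.Nullary using (¬_)
open import Relation.Binary.PropositionalEquality using (_≡_; _≢_)
open import Relation.Binary.Construct.Closure.ReflexiveTransitive using (Star)
open import Function.Bundles using (_⇔_; _↔_)

-- Processes and actions.  The finite set 𝒫 of processes is Fin n.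

data Action (n : ℕ) : Set where
  send : (p q : Fin n) → Action n
  recv : (p q : Fin n) → Action n   -- p?q  (p receives from q)

ValidAction : ∀ {n} → Action n → Set
ValidAction (send p q) = p ≢ q
ValidAction (recv p q) = p ≢ q

procOf : ∀ {n} → Action n → Fin n
procOf (send p q) = p
procOf (recv p q) = p

HasCard : {V : Set} → (V → Set) → ℕ → Set
HasCard {V} P k =
  Σ (List V) λ xs → Unique xs × (∀ x → P x ⇔ (x ∈ xs)) × length xs ≡ k

IsFinite : {V : Set} → (V → Set) → Set
IsFinite P = ∃[ k ] HasCard P k

InfinitelyMany : (ℕ → Set) → Set
InfinitelyMany P = ¬ (Σ (List ℕ) λ xs → ∀ i → P i → i ∈ xs)

record LPoset (n : ℕ) : Set₁ where
  field
    V       : Set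
    _≤_     : V → V → Set
    lab     : V → Action n
    lab-valid : ∀ v → ValidAction (lab v)
    ≤-refl  : ∀ v → v ≤ v
    ≤-trans : ∀ {u v w} → u ≤ v → v ≤ w → u ≤ w
    ≤-antisym : ∀ {u v} → u ≤ v → v ≤ u → u ≡ v

  P : V → Fin n
  P v = procOf (lab v)

  _<_ : V → V → Set
  u < v = u ≤ v × u ≢ v

  Proc : V → V → Set
  Proc v v' = P v ≡ P v' × v < v'
            × ¬ (∃[ w ] (P w ≡ P v × v < w × w < v'))

  Msg : V → V → Set
  Msg v v' = ∃[ p ] ∃[ q ] (p ≢ q × lab v ≡ send p q × lab v' ≡ recv q p
           × ∃[ k ] (HasCard (λ u → u ≤ v × lab u ≡ send p q) k
                    × HasCard (λ u → u ≤ v' × lab u ≡ recv q p) k))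

  Edge : V → V → Set
  Edge v v' = Proc v v' ⊎ Msg v v'

record IsMSC {n : ℕ} (M : LPoset n) : Set₁ where
  open LPoset M
  field
    ≤-is-closure : ∀ u w → (u ≤ w) ⇔ Star Edge u w
    down-finite  : ∀ v → IsFinite (λ u → u ≤ v)
    proc-linear  : ∀ u w → P u ≡ P w → (u ≤ w) ⊎ (w ≤ u)
    channel-bal  : ∀ (p q : Fin n) → p ≢ q →
                   (Σ V λ v → lab v ≡ send p q) ↔ (Σ V λ v → lab v ≡ recv q p)

record MSC (n : ℕ) : Set₂ where
  field
    poset : LPoset n
    isMSC : IsMSC poset
  open LPoset poset public

module _ {n : ℕ} (M : MSC n) (c : MSC.V M → Bool) where
  open MSC M

  _∼_ : V → V → Set
  u ∼ w = P u ≡ P w ×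
          (∀ v → ((u ≤ v × v ≤ w) ⊎ (w ≤ v × v ≤ u)) → P v ≡ P u →
                 c u ≡ c v × c v ≡ c w)

  record InCol : Set where
    field
      col-min   : ∀ v → ¬ (∃[ w ] (P w ≡ P v × w < v)) → c v ≡ true
      col-msg   : ∀ v v' → Msg v v' → ∀ w' → w' ≤ v' → P w' ≡ P v' →
                  ∃[ u ] ∃[ u' ] (Msg u u' × lab u' ≡ lab v' × c u ≡ c u' × u' ∼ w')
      col-fin   : ∀ u → IsFinite (λ w → u ∼ w)

-- A chain of alternately coloured nodes ending at v' on its process can be pulled back across a
-- monochromatic edge (v, v'): directly along a process edge, and along a message edge by
-- condition (2) of Col and the FIFO order of channels.  If colours were eventually constant
-- along the infinite path, the alternation depth of its nodes (bounded by the size of a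
-- down-set) would be non-increasing, hence eventually constant, say K.  Nodes of one process
-- with depth K are ∼-equivalent, so the tail of the path would lie in finitely many finite
-- ∼-classes, contradicting the injectivity of the path.
module Submission where

open import Defs
open import Data.Nat using (ℕ; zero; suc; _+_; _≤′_; ≤′-refl; ≤′-step)
import Data.Nat as ℕ
import Data.Nat.Properties as ℕₚ
open import Data.Nat.ListAction using (sum)
open import Data.Bool using (Bool) renaming (_≟_ to _≟ᵇ_)
open import Data.Fin using (Fin)
import Data.Fin.Properties as Finₚ
open import Data.List using (List; []; _∷_; length; lookup; _++_; allFin)
open import Data.List.Membership.Propositional using (_∈_)
open import Data.List.Membership.Propositional.Properties
  using (∈-lookup; ∈-length; ∈-++⁺ˡ; ∈-++⁺ʳ; ∈-allFin; finite)
open import Data.List.Relation.Binary.Subset.Propositional using (_⊆_)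
open import Data.List.Relation.Unary.Any using (here; there; index)
open import Data.List.Relation.Unary.Any.Properties using (lookup-index)
import Data.List.Relation.Unary.All as All
open import Data.List.Relation.Unary.Unique.Propositional using (Unique)
open import Data.List.Relation.Unary.AllPairs using (_∷_)
open import Data.Product using (∃; _×_; _,_; proj₁; proj₂)
open import Data.Sum using (_⊎_; inj₁; inj₂)
open import Data.Empty using (⊥)
open import Function using (_∘_)
open import Function.Bundles using (Equivalence; mk↣)
open import Relation.Binary using (tri<; tri≈; tri>)
open import Relation.Binary.PropositionalEquality
  using (_≡_; _≢_; refl; sym; trans; cong; subst)
open import Relation.Binary.Construct.Closure.ReflexiveTransitive using (ε; _◅_)
open import Relation.Nullary using (¬_; yes; no; contradiction)
open import Relation.Nullary.Decidable using (decidable-stable; ¬¬-excluded-middle)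

module _ {V : Set} where

  Unique⇒lookup-injective : ∀ {xs : List V} → Unique xs →
                            ∀ i j → lookup xs i ≡ lookup xs j → i ≡ j
  Unique⇒lookup-injective (_ ∷ _)   Fin.zero    Fin.zero    _  = refl
  Unique⇒lookup-injective (x∉ ∷ _)  Fin.zero    (Fin.suc j) eq =
    contradiction eq (All.lookup x∉ (∈-lookup j))
  Unique⇒lookup-injective (x∉ ∷ _)  (Fin.suc i) Fin.zero    eq =
    contradiction (sym eq) (All.lookup x∉ (∈-lookup i))
  Unique⇒lookup-injective (_ ∷ un)  (Fin.suc i) (Fin.suc j) eq =
    cong Fin.suc (Unique⇒lookup-injective un i j eq)

  Unique⇒length-mono : ∀ {xs ys : List V} → Unique xs → xs ⊆ ys → length xs ℕ.≤ length ys
  Unique⇒length-mono {xs} {ys} un xs⊆ys = Finₚ.injective⇒≤ injective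
    where
    position : Fin (length xs) → Fin (length ys)
    position i = index (xs⊆ys (∈-lookup i))

    injective : ∀ {i j} → position i ≡ position j → i ≡ j
    injective {i} {j} eq = Unique⇒lookup-injective un i j
      (trans (lookup-index (xs⊆ys (∈-lookup i)))
        (trans (cong (lookup ys) eq) (sym (lookup-index (xs⊆ys (∈-lookup j))))))

  HasCard-mono-≤ : ∀ {A B : V → Set} {a b} → (∀ x → A x → B x) →
                   HasCard A a → HasCard B b → a ℕ.≤ b
  HasCard-mono-≤ A⊆B (xs , un , A⇔xs , refl) (ys , _ , B⇔ys , refl) =
    Unique⇒length-mono un (λ {x} → Equivalence.to (B⇔ys x) ∘ A⊆B x ∘ Equivalence.from (A⇔xs x))

  HasCard-mono-< : ∀ {A B : V → Set} {a b} → (∀ x → A x → B x) →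
                   HasCard A a → HasCard B b → ∀ y → B y → ¬ A y → a ℕ.< b
  HasCard-mono-< A⊆B (xs , un , A⇔xs , refl) (ys , _ , B⇔ys , refl) y By ¬Ay =
    Unique⇒length-mono (All.tabulate y∉xs ∷ un) y∷xs⊆ys
    where
    y∉xs : ∀ {x} → x ∈ xs → y ≢ x
    y∉xs x∈xs refl = ¬Ay (Equivalence.from (A⇔xs y) x∈xs)

    y∷xs⊆ys : y ∷ xs ⊆ ys
    y∷xs⊆ys (here refl) = Equivalence.to (B⇔ys y) By
    y∷xs⊆ys (there x∈xs) = Equivalence.to (B⇔ys _) (A⊆B _ (Equivalence.from (A⇔xs _) x∈xs))

  HasCard-inhabited : ∀ {A : V → Set} {a} → HasCard A a → ∀ y → A y → 0 ℕ.< a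
  HasCard-inhabited (xs , _ , A⇔xs , refl) y Ay = ∈-length (Equivalence.to (A⇔xs y) Ay)

∈⇒≤sum : ∀ {i} {xs : List ℕ} → i ∈ xs → i ℕ.≤ sum xs
∈⇒≤sum {xs = x ∷ xs} (here refl)  = ℕₚ.m≤m+n x (sum xs)
∈⇒≤sum {xs = x ∷ xs} (there i∈xs) = ℕₚ.≤-trans (∈⇒≤sum i∈xs) (ℕₚ.m≤n+m (sum xs) x)

listed⇒eventually-¬ : ∀ {Q : ℕ → Set} (xs : List ℕ) → (∀ i → Q i → i ∈ xs) →
                      ∀ i → suc (sum xs) ℕ.≤ i → ¬ Q i
listed⇒eventually-¬ xs listed i sum<i Qi = ℕₚ.<⇒≱ sum<i (∈⇒≤sum (listed i Qi))

module Coloured {n : ℕ} (M : MSC n) (c : MSC.V M → Bool) (col : InCol M c) where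
  open MSC M
  open IsMSC isMSC
  open InCol col

  _≈_ : V → V → Set
  _≈_ = _∼_ M c

  <-≤-trans : ∀ {u v w} → u < v → v ≤ w → u < w
  <-≤-trans (u≤v , u≢v) v≤w =
    ≤-trans u≤v v≤w , λ { refl → u≢v (≤-antisym u≤v v≤w) }

  ≢colour⇒< : ∀ {u v} → u ≤ v → c u ≢ c v → u < v
  ≢colour⇒< u≤v cu≢cv = u≤v , cu≢cv ∘ cong c

  Edge⇒< : ∀ {v v'} → Edge v v' → v < v'
  Edge⇒< (inj₁ (_ , v<v' , _)) = v<v'
  Edge⇒< {v} {v'} (inj₂ m@(_ , _ , _ , lab-v , lab-v' , _)) =
    Equivalence.from (≤-is-closure v v') (inj₂ m ◅ ε) ,
    λ { refl → send≢recv (trans (sym lab-v) lab-v') }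
    where
    send≢recv : ∀ {p q q' p' : Fin n} → send p q ≢ recv q' p'
    send≢recv ()

  ≈-refl : ∀ u → u ≈ u
  ≈-refl u = refl , λ { v (inj₁ (u≤v , v≤u)) _ → collapse (≤-antisym u≤v v≤u)
                      ; v (inj₂ (u≤v , v≤u)) _ → collapse (≤-antisym u≤v v≤u) }
    where
    collapse : ∀ {v} → u ≡ v → c u ≡ c v × c v ≡ c u
    collapse refl = refl , refl

  ≈⇒≡colour : ∀ {u w} → u ≈ w → c u ≡ c w
  ≈⇒≡colour {u} {w} (Pu≡Pw , between) with proc-linear u w Pu≡Pw
  ... | inj₁ u≤w = proj₁ (between w (inj₁ (u≤w , ≤-refl w)) (sym Pu≡Pw))
  ... | inj₂ w≤u = proj₁ (between w (inj₂ (≤-refl w , w≤u)) (sym Pu≡Pw))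

  -- ∼-classes are intervals of their process, so distinct classes are ordered like their members.
  ≈-classes-ordered : ∀ {a x b y} → a ≈ x → b ≈ y → x ≤ y → P x ≡ P y → c x ≢ c y → a < b
  ≈-classes-ordered {a} {x} {b} {y} a≈x@(Pa≡Px , a⋯x) b≈y@(Pb≡Py , b⋯y) x≤y Px≡Py cx≢cy
    with proc-linear a b (trans Pa≡Px (trans Px≡Py (sym Pb≡Py)))
  ... | inj₁ a≤b = ≢colour⇒< a≤b λ ca≡cb →
                     cx≢cy (trans (sym (≈⇒≡colour a≈x)) (trans ca≡cb (≈⇒≡colour b≈y)))
  ... | inj₂ b≤a with proc-linear a y (trans Pa≡Px Px≡Py)
  ...   | inj₁ a≤y = contradiction
            (trans (sym (≈⇒≡colour a≈x))
                   (proj₂ (b⋯y a (inj₁ (b≤a , a≤y)) (trans Pa≡Px (trans Px≡Py (sym Pb≡Py))))))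
            cx≢cy
  ...   | inj₂ y≤a = contradiction
            (sym (proj₂ (a⋯x y (inj₂ (x≤y , y≤a)) (trans (sym Px≡Py) (sym Pa≡Px)))))
            cx≢cy

  -- Msg pairs the k-th send of a channel with its k-th receive, so channels are FIFO.
  Msg-fifo : ∀ {s r s' r'} → Msg s r → Msg s' r' → lab r ≡ lab r' → r < r' →
             s < s' × P s ≡ P s'
  Msg-fifo {s} {r} {s'} {r'} (_ , _ , _ , lab-s , lab-r , k , sends-s , recvs-r)
                             (_ , _ , _ , lab-s' , lab-r' , k' , sends-s' , recvs-r')
                             lab-r≡lab-r' (r≤r' , r≢r')
    with trans (sym lab-r) (trans lab-r≡lab-r' lab-r')
  ... | refl = ordered (proc-linear s s' Ps≡Ps')
    where
    Ps≡Ps' : P s ≡ P s'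
    Ps≡Ps' = cong procOf (trans lab-s (sym lab-s'))

    k<k' : k ℕ.< k'
    k<k' = HasCard-mono-< (λ _ (x≤r , lab-x) → ≤-trans x≤r r≤r' , lab-x) recvs-r recvs-r'
             r' (≤-refl r' , lab-r') (λ (r'≤r , _) → r≢r' (≤-antisym r≤r' r'≤r))

    s'≰s : ¬ s' ≤ s
    s'≰s s'≤s = ℕₚ.<⇒≱ k<k'
      (HasCard-mono-≤ (λ _ (x≤s' , lab-x) → ≤-trans x≤s' s'≤s , lab-x) sends-s' sends-s)

    ordered : (s ≤ s') ⊎ (s' ≤ s) → s < s' × P s ≡ P s'
    ordered (inj₁ s≤s') = (s≤s' , λ { refl → s'≰s (≤-refl s) }) , Ps≡Ps'
    ordered (inj₂ s'≤s) = contradiction s'≤s s'≰s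

  -- Chain v k: nodes x₁ < … < x_k = v of the process of v, consecutive ones differently
  -- coloured; so v lies at least k − 1 colour changes up its process.
  data Chain (v : V) : ℕ → Set where
    one : Chain v 1
    ext : ∀ {x k} → Chain x k → x ≤ v → P x ≡ P v → c x ≢ c v → Chain v (suc k)

  Chain-raise : ∀ {x y k} → Chain x k → x ≤ y → P x ≡ P y → c x ≡ c y → Chain y k
  Chain-raise one _ _ _ = one
  Chain-raise (ext ch z≤x Pz≡Px cz≢cx) x≤y Px≡Py cx≡cy =
    ext ch (≤-trans z≤x x≤y) (trans Pz≡Px Px≡Py) (λ cz≡cy → cz≢cx (trans cz≡cy (sym cx≡cy)))

  Chain-drop : ∀ {v k} → Chain v (suc (suc k)) → Chain v (suc k)
  Chain-drop {k = zero}  _                 = one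
  Chain-drop {k = suc k} (ext ch x≤v Px≡Pv cx≢cv) = ext (Chain-drop ch) x≤v Px≡Pv cx≢cv

  Chain-mono : ∀ {x y k} → Chain x k → x ≤ y → P x ≡ P y → Chain y k
  Chain-mono {x} {y} {zero} () _ _
  Chain-mono {x} {y} {suc k} ch x≤y Px≡Py with c x ≟ᵇ c y
  ... | yes cx≡cy = Chain-raise ch x≤y Px≡Py cx≡cy
  ... | no  cx≢cy = Chain-drop (ext ch x≤y Px≡Py cx≢cy)

  Chain-length≤ : ∀ {v k} → Chain v k → k ℕ.≤ proj₁ (down-finite v)
  Chain-length≤ {v} one = HasCard-inhabited (proj₂ (down-finite v)) v (≤-refl v)
  Chain-length≤ {v} (ext {x} ch x≤v _ cx≢cv) =
    ℕₚ.≤-trans (ℕ.s≤s (Chain-length≤ ch))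
      (HasCard-mono-< (λ _ z≤x → ≤-trans z≤x x≤v) (proj₂ (down-finite x)) (proj₂ (down-finite v))
                      v (≤-refl v) (λ v≤x → cx≢cv (cong c (≤-antisym x≤v v≤x))))

  -- Each link x < w of the chain is matched, via condition (2), by an earlier message whose
  -- receive is ∼ x; FIFO orders the matching sends like the receives.
  Chain-pullback-msg : ∀ {s r w k} → Msg s r → c s ≡ c r → r ≈ w → Chain w k → Chain s k
  Chain-pullback-msg _ _ _ one = one
  Chain-pullback-msg {s} {r} {w} m cs≡cr r≈w (ext {x} ch x≤w Px≡Pw cx≢cw) =
    link (col-msg s r m x (proj₁ x<r) (trans Px≡Pw (sym (proj₁ r≈w))))
    where
    x<r : x < r
    x<r = ≈-classes-ordered (≈-refl x) r≈w x≤w Px≡Pw cx≢cw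

    link : ∃ (λ sx → ∃ λ rx → Msg sx rx × lab rx ≡ lab r × c sx ≡ c rx × rx ≈ x) → Chain s _
    link (sx , rx , mx , lab-rx , csx≡crx , rx≈x) =
      ext (Chain-pullback-msg mx csx≡crx rx≈x ch) (proj₁ sx<s) Psx≡Ps (cx≢cw ∘ reflect-colour)
      where
      rx<r : rx < r
      rx<r = ≈-classes-ordered rx≈x r≈w x≤w Px≡Pw cx≢cw

      sx<s : sx < s
      sx<s = proj₁ (Msg-fifo mx m lab-rx rx<r)

      Psx≡Ps : P sx ≡ P s
      Psx≡Ps = proj₂ (Msg-fifo mx m lab-rx rx<r)

      reflect-colour : c sx ≡ c s → c x ≡ c w
      reflect-colour csx≡cs =
        trans (sym (≈⇒≡colour rx≈x))
          (trans (sym csx≡crx) (trans csx≡cs (trans cs≡cr (≈⇒≡colour r≈w))))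

  Chain-pullback-proc : ∀ {v v' k} → Proc v v' → c v ≡ c v' → Chain v' k → Chain v k
  Chain-pullback-proc _ _ one = one
  Chain-pullback-proc {v} {v'} (Pv≡Pv' , _ , nothing-between) cv≡cv'
                      (ext {x} ch x≤v' Px≡Pv' cx≢cv') = below (proc-linear x v Px≡Pv)
    where
    Px≡Pv : P x ≡ P v
    Px≡Pv = trans Px≡Pv' (sym Pv≡Pv')

    below : (x ≤ v) ⊎ (v ≤ x) → Chain v _
    below (inj₁ x≤v) = ext ch x≤v Px≡Pv (λ cx≡cv → cx≢cv' (trans cx≡cv cv≡cv'))
    below (inj₂ v≤x) = contradiction
      (x , Px≡Pv , ≢colour⇒< v≤x (λ cv≡cx → cx≢cv' (trans (sym cv≡cx) cv≡cv')) ,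
       ≢colour⇒< x≤v' cx≢cv')
      nothing-between

  Chain-pullback : ∀ {v v' k} → Edge v v' → c v ≡ c v' → Chain v' k → Chain v k
  Chain-pullback (inj₁ pr) = Chain-pullback-proc pr
  Chain-pullback (inj₂ m) cv≡cv' = Chain-pullback-msg m cv≡cv' (≈-refl _)

  same-depth-colour : ∀ {a b z K} → ¬ ¬ Chain a K → ¬ Chain b (suc K) →
                      a ≤ z → z ≤ b → P a ≡ P z → P z ≡ P b → c a ≡ c z × c z ≡ c b
  same-depth-colour {a} {b} {z} chain-a no-chain-b a≤z z≤b Pa≡Pz Pz≡Pb =
    decidable-stable (c a ≟ᵇ c z)
      (λ ca≢cz → chain-a λ ch → no-chain-b (Chain-mono (ext ch a≤z Pa≡Pz ca≢cz) z≤b Pz≡Pb)) ,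
    decidable-stable (c z ≟ᵇ c b)
      (λ cz≢cb → chain-a λ ch → no-chain-b (ext (Chain-mono ch a≤z Pa≡Pz) z≤b Pz≡Pb cz≢cb))

  same-depth⇒≈ : ∀ {a b K} → ¬ ¬ Chain a K → ¬ ¬ Chain b K →
                 ¬ Chain a (suc K) → ¬ Chain b (suc K) → P a ≡ P b → a ≈ b
  same-depth⇒≈ chain-a chain-b no-chain-a no-chain-b Pa≡Pb = Pa≡Pb , λ where
    z (inj₁ (a≤z , z≤b)) Pz≡Pa →
      same-depth-colour chain-a no-chain-b a≤z z≤b (sym Pz≡Pa) (trans Pz≡Pa Pa≡Pb)
    z (inj₂ (b≤z , z≤a)) Pz≡Pa →
      let (cb≡cz , cz≡ca) = same-depth-colour chain-b no-chain-a b≤z z≤a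
                                                (sym (trans Pz≡Pa Pa≡Pb)) Pz≡Pa
      in sym cz≡ca , sym cb≡cz

  class : V → List V
  class u = proj₁ (proj₂ (col-fin u))

  ≈⇒∈class : ∀ {u x} → u ≈ x → x ∈ class u
  ≈⇒∈class {u} {x} = Equivalence.to (proj₁ (proj₂ (proj₂ (proj₂ (col-fin u)))) x)

  module Path (w : ℕ → V) (edge : ∀ i → Edge (w i) (w (suc i))) where

    path-≤ : ∀ {i j} → i ≤′ j → w i ≤ w j
    path-≤ {i} ≤′-refl      = ≤-refl (w i)
    path-≤     (≤′-step i≤j) = ≤-trans (path-≤ i≤j) (proj₁ (Edge⇒< (edge _)))

    path-< : ∀ {i j} → i ℕ.< j → w i < w j
    path-< {i} i<j = <-≤-trans (Edge⇒< (edge i)) (path-≤ (ℕₚ.≤⇒≤′ i<j))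

    path-injective : ∀ {i j} → w i ≡ w j → i ≡ j
    path-injective {i} {j} wi≡wj with ℕₚ.<-cmp i j
    ... | tri< i<j _ _ = contradiction wi≡wj (proj₂ (path-< i<j))
    ... | tri≈ _ i≡j _ = i≡j
    ... | tri> _ _ j<i = contradiction (sym wi≡wj) (proj₂ (path-< j<i))

    module ConstantDepth (m : ℕ) (K : ℕ) (depth-≥ : ∀ t → m ℕ.≤ t → ¬ ¬ Chain (w t) K)
                (depth-< : ∀ t → m ℕ.≤ t → ¬ Chain (w t) (suc K)) where

      tail-covered : (ps : List (Fin n)) →
                     ¬ ¬ (∃ λ L → ∀ t → m ℕ.≤ t → P (w t) ∈ ps → w t ∈ L)
      tail-covered []       k = k ([] , λ _ _ ())
      tail-covered (p ∷ ps) k =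
        ¬¬-excluded-middle {A = ∃ λ t → m ℕ.≤ t × P (w t) ≡ p} λ hit? →
        tail-covered ps λ (L , covered) → k (representative hit? ++ L , extend hit? covered)
        where
        representative : _ → List V
        representative (yes (t , _)) = class (w t)
        representative (no _)        = []

        extend : ∀ {L} hit? → (∀ t → m ℕ.≤ t → P (w t) ∈ ps → w t ∈ L) →
                 ∀ t → m ℕ.≤ t → P (w t) ∈ p ∷ ps → w t ∈ representative hit? ++ L
        extend (yes (t' , m≤t' , Pt'≡p)) _ t m≤t (here Pt≡p) = ∈-++⁺ˡ (≈⇒∈class
          (same-depth⇒≈ (depth-≥ t' m≤t') (depth-≥ t m≤t) (depth-< t' m≤t') (depth-< t m≤t)
                        (trans Pt'≡p (sym Pt≡p))))
        extend (no none) _ t m≤t (here Pt≡p) = contradiction (t , m≤t , Pt≡p) none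
        extend hit? covered t m≤t (there Pt∈ps) =
          ∈-++⁺ʳ (representative hit?) (covered t m≤t Pt∈ps)

      absurd : ⊥
      absurd = tail-covered (allFin n) λ (L , covered) →
        finite (mk↣ shifted-injective) L
          (λ t → covered (t + m) (ℕₚ.m≤n+m m t) (∈-allFin (P (w (t + m)))))
        where
        shifted-injective : ∀ {t t'} → w (t + m) ≡ w (t' + m) → t ≡ t'
        shifted-injective eq = ℕₚ.+-cancelʳ-≡ m _ _ (path-injective eq)

    module EventuallyMonochromatic (N : ℕ)
             (monochromatic : ∀ i → N ℕ.≤ i → c (w i) ≡ c (w (suc i))) where

      Chain-pullback-path : ∀ {i j k} → N ℕ.≤ i → i ≤′ j → Chain (w j) k → Chain (w i) k
      Chain-pullback-path N≤i ≤′-refl ch = ch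
      Chain-pullback-path N≤i (≤′-step {j} i≤j) ch =
        Chain-pullback-path N≤i i≤j
          (Chain-pullback (edge j) (monochromatic j (ℕₚ.≤-trans N≤i (ℕₚ.≤′⇒≤ i≤j))) ch)

      depth-unbounded : ∀ k m → N ℕ.≤ m → ¬ (∀ t → m ℕ.≤ t → ¬ Chain (w t) (suc k))
      depth-unbounded zero    m _   none = none m ℕₚ.≤-refl one
      depth-unbounded (suc k) m N≤m none =
        ¬¬-excluded-middle {A = ∃ λ t → m ℕ.≤ t × ¬ Chain (w t) (suc k)} λ where
          (yes (t , m≤t , no-chain)) →
            depth-unbounded k t (ℕₚ.≤-trans N≤m m≤t) λ j t≤j ch →
              no-chain (Chain-pullback-path (ℕₚ.≤-trans N≤m m≤t) (ℕₚ.≤⇒≤′ t≤j) ch)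
          (no all-chains) →
            ConstantDepth.absurd m (suc k) (λ t m≤t no-chain → all-chains (t , m≤t , no-chain)) none

      absurd : ⊥
      absurd =
        depth-unbounded (proj₁ (down-finite (w N))) N ℕₚ.≤-refl λ t N≤t ch →
          ℕₚ.1+n≰n (Chain-length≤ (Chain-pullback-path ℕₚ.≤-refl (ℕₚ.≤⇒≤′ N≤t) ch))

corollary3p9 : ∀ {n : ℕ} (M : MSC n) (c : MSC.V M → Bool) → InCol M c →
               (v : ℕ → MSC.V M) → (∀ i → MSC.Edge M (v i) (v (suc i))) →
               InfinitelyMany (λ i → c (v i) ≢ c (v (suc i)))
corollary3p9 M c col v edge (changes , listed) =
  Coloured.Path.EventuallyMonochromatic.absurd M c col v edge
    (suc (sum changes)) monochromatic
  where
  monochromatic : ∀ i → suc (sum changes) ℕ.≤ i → c (v i) ≡ c (v (suc i))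
  monochromatic i bound = decidable-stable (c (v i) ≟ᵇ c (v (suc i)))
                            (listed⇒eventually-¬ changes listed i bound)
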